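{- Let $\Phi$ be a QCTL formula, $\mathcal{K}=\langle V,E,\ell\rangle$ a Kripke structure with $V=\{x_0,\ldots,x_n\}$, $x\in V$, $\varepsilon:AP_Q^\Phi\to 2^V$ an environment (partial map) and $\varphi$ a subformula of $\Phi$. If $\widehat{\varphi}^{\,x,\mathrm{dom}(\varepsilon)}$ is the QBF formula defined inductively by the translation rules given in the context, then \[\mathcal{K},x\models_\varepsilon\varphi \quad\text{iff}\quad v_\varepsilon\models\widehat{\varphi}^{\,x,\mathrm{dom}(\varepsilon)}.\]
   Context: Kripke structure: $\langle V,E,\ell\rangle$ with $V$ finite, $E\subseteq V\times V$ such that every vertex has a successor, $\ell:V\to 2^{AP}$ for a finite set $AP$ of atomic propositions. QCTL formulas: $\varphi::= q\mid\neg\varphi\mid\varphi\vee\varphi\mid \mathsf{EX}\varphi\mid \mathsf{E}\varphi\mathsf{U}\varphi\mid\mathsf{A}\varphi\mathsf{U}\varphi\mid\exists p.\varphi$, with abbreviations $\wedge$, $\forall p=\neg\exists p\neg$, $\mathsf{AX}\varphi=\neg\mathsf{EX}\neg\varphi$, $\mathsf{EF}\varphi=\mathsf{E}\top\mathsf{U}\varphi$, $\mathsf{AG}\varphi=\neg\mathsf{EF}\neg\varphi$ (formulas may use $\wedge,\mathsf{AX},\mathsf{EF},\mathsf{AG}$ directly, translated by the dedicated rules below). Standard CTL semantics over infinite paths: $\mathsf{E}\varphi\mathsf{U}\psi$ (resp. $\mathsf{A}\varphi\mathsf{U}\psi$) holds at $x$ iff some (resp. every) infinite path from $x$ reaches a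 state satisfying $\psi$ with all earlier states satisfying $\varphi$. Standing assumption: every quantifier in $\Phi$ introduces a fresh atomic proposition, distinct from the propositions used in $\mathcal{K}$; $AP_Q^\Phi$ is the set of quantified propositions of $\Phi$. An environment is a partial map $\varepsilon:AP_Q^\Phi\to 2^V$. Semantics with environment: $\mathcal{K},x\models_\varepsilon p$ iff ($p\in AP_Q^\Phi$ and $x\in\varepsilon(p)$) or ($p\notin AP_Q^\Phi$ and $p\in\ell(x)$); $\mathcal{K},x\models_\varepsilon\exists p.\varphi$ iff there is $V'\subseteq V$ with $\mathcal{K},x\models_{\varepsilon[p\mapsto V']}\varphi$ (where $\varepsilon[p\mapsto V']$ agrees with $\varepsilon$ except it maps $p$ to $V'$); other operators as in CTL. QBF: formulas $\alpha::= q\mid\alpha\vee\alpha\mid\neg\alpha\mid\exists q.\alpha$ (with usual abbreviations), evaluated under Boolean valuations of free variables. The QBF variables are $p^{y}$ for $p\in AP_Q^\Phi$, $y\in V$. The valuation $v_\varepsilon$ sets $v_\varepsilon(p^y)=\top$ iff $y\in\varepsilon(p)$ (for $p\in\mathrm{dom}(\varepsilon)$). $E^*$ is the reflexive-transitive closure of $E$. Translation rules ($P\subseteq AP_Q^\Phi$): $\widehat{\neg\varphi}^{x,P}=\neg\widehat{\varphi}^{x,P}$; $\widehat{\varphi\vee\psi}^{x,P}=\widehat{\varphi}^{x,P}\vee\widehat{\psi}^{x,P}$; $\widehat{\varphi\wedge\psi}^{x,P}=\widehat{\varphi}^{x,P}\wedge\widehat{\psi}^{x,P}$; $\widehat{\exists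 p.\varphi}^{x,P}=\exists p^{x_0}\ldots\exists p^{x_n}.\widehat{\varphi}^{x,P\cup\{p\}}$; $\widehat{p}^{x,P}=p^x$ if $p\in P$, $\top$ if $p\notin P$ and $p\in\ell(x)$, $\bot$ otherwise; $\widehat{\mathsf{EX}\varphi}^{x,P}=\bigvee_{(x,x')\in E}\widehat{\varphi}^{x',P}$; $\widehat{\mathsf{AX}\varphi}^{x,P}=\bigwedge_{(x,x')\in E}\widehat{\varphi}^{x',P}$; $\widehat{\mathsf{EF}\varphi}^{x,P}=\bigvee_{(x,x')\in E^*}\widehat{\varphi}^{x',P}$; $\widehat{\mathsf{AG}\varphi}^{x,P}=\bigwedge_{(x,x')\in E^*}\widehat{\varphi}^{x',P}$; $\widehat{\mathsf{E}\varphi\mathsf{U}\psi}^{x,P}=\overline{\mathsf{E}\varphi\mathsf{U}\psi}^{x,P,\{x\}}$ where $\overline{\mathsf{E}\varphi\mathsf{U}\psi}^{x,P,X}=\widehat{\psi}^{x,P}\vee\big(\widehat{\varphi}^{x,P}\wedge\bigvee_{(x,x')\in E,\,x'\notin X}\overline{\mathsf{E}\varphi\mathsf{U}\psi}^{x',P,X\cup\{x'\}}\big)$; $\widehat{\mathsf{A}\varphi\mathsf{U}\psi}^{x,P}=\overline{\mathsf{A}\varphi\mathsf{U}\psi}^{x,P,\{x\}}$ where $\overline{\mathsf{A}\varphi\mathsf{U}\psi}^{x,P,X}=\widehat{\psi}^{x,P}$ if there is $(x,x')\in E$ with $x'\in X$, and otherwise $\widehat{\psi}^{x,P}\vee\big(\widehat{\varphi}^{x,P}\wedge\bigwedge_{(x,x')\in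 E}\overline{\mathsf{A}\varphi\mathsf{U}\psi}^{x',P,X\cup\{x'\}}\big)$. (Empty disjunction is $\bot$, empty conjunction $\top$.) -}

module Defs where

open import Data.Nat using (ℕ; zero; suc; _<_; _≡ᵇ_)
open import Data.Fin using (Fin)
open import Data.Fin.Properties using () renaming (_≟_ to _≟F_)
open import Data.Bool using (Bool; true; false; _∨_; _∧_; if_then_else_)
open import Data.Maybe using (Maybe; just; nothing; is-just; maybe)
open import Data.List using (List; []; _∷_; filter; foldr; map; allFin)
open import Data.Bool.ListAction using (any)
open import Data.List.Membership.Propositional using (_∈_; _∉_)
import Data.List.Membership.DecPropositional as DecMem
open import Data.Product using (Σ; ∃; ∃-syntax; _×_; _,_)
open import Data.Sum using (_⊎_)
open import Data.Unit using (⊤)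
open import Relation.Nullary using (¬_; Dec; does; ¬?)
open import Relation.Binary.PropositionalEquality using (_≡_)
open import Relation.Binary.Construct.Closure.ReflexiveTransitive using (Star)

record Kripke (N : ℕ) : Set₁ where
  field
    E      : Fin N → Fin N → Set
    E?     : (x y : Fin N) → Dec (E x y)
    serial : (x : Fin N) → ∃[ y ] E x y
    ℓ      : Fin N → ℕ → Bool

infixr 6 _∧f_
infixr 5 _∨f_

data Form : Set where
  atom      : ℕ → Form
  ¬f_       : Form → Form
  _∨f_ _∧f_ : Form → Form → Form
  EX AX EF AG : Form → Form
  EU AU     : Form → Form → Form
  ∃f        : ℕ → Form → Form

-- AP_Q^Φ : the quantified propositions of Φ (as a list, one entry per quantifier)
qprops : Form → List ℕ
qprops (atom p) = []
qprops (¬f φ) = qprops φ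
qprops (φ ∨f ψ) = qprops φ Data.List.++ qprops ψ
qprops (φ ∧f ψ) = qprops φ Data.List.++ qprops ψ
qprops (EX φ) = qprops φ
qprops (AX φ) = qprops φ
qprops (EF φ) = qprops φ
qprops (AG φ) = qprops φ
qprops (EU φ ψ) = qprops φ Data.List.++ qprops ψ
qprops (AU φ ψ) = qprops φ Data.List.++ qprops ψ
qprops (∃f p φ) = p ∷ qprops φ

data _⊑_ (φ : Form) : Form → Set where
  ⊑-refl : φ ⊑ φ
  ⊑-¬    : ∀ {ψ} → φ ⊑ ψ → φ ⊑ (¬f ψ)
  ⊑-∨ˡ   : ∀ {ψ χ} → φ ⊑ ψ → φ ⊑ (ψ ∨f χ)
  ⊑-∨ʳ   : ∀ {ψ χ} → φ ⊑ χ → φ ⊑ (ψ ∨f χ)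
  ⊑-∧ˡ   : ∀ {ψ χ} → φ ⊑ ψ → φ ⊑ (ψ ∧f χ)
  ⊑-∧ʳ   : ∀ {ψ χ} → φ ⊑ χ → φ ⊑ (ψ ∧f χ)
  ⊑-EX   : ∀ {ψ} → φ ⊑ ψ → φ ⊑ EX ψ
  ⊑-AX   : ∀ {ψ} → φ ⊑ ψ → φ ⊑ AX ψ
  ⊑-EF   : ∀ {ψ} → φ ⊑ ψ → φ ⊑ EF ψ
  ⊑-AG   : ∀ {ψ} → φ ⊑ ψ → φ ⊑ AG ψ
  ⊑-EUˡ  : ∀ {ψ χ} → φ ⊑ ψ → φ ⊑ EU ψ χ
  ⊑-EUʳ  : ∀ {ψ χ} → φ ⊑ χ → φ ⊑ EU ψ χ
  ⊑-AUˡ  : ∀ {ψ χ} → φ ⊑ ψ → φ ⊑ AU ψ χ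
  ⊑-AUʳ  : ∀ {ψ χ} → φ ⊑ χ → φ ⊑ AU ψ χ
  ⊑-∃    : ∀ {p ψ} → φ ⊑ ψ → φ ⊑ ∃f p ψ

Env : ℕ → Set
Env N = ℕ → Maybe (Fin N → Bool)

dom : ∀ {N} → Env N → ℕ → Bool
dom ε p = is-just (ε p)

_[_↦_] : ∀ {N} → Env N → ℕ → (Fin N → Bool) → Env N
(ε [ p ↦ S ]) q = if q ≡ᵇ p then just S else ε q

inEnv : ∀ {N} → Env N → ℕ → Fin N → Bool
inEnv ε p y = maybe (λ S → S y) false (ε p)

-- Semantics  K, x ⊨_ε φ  relative to the set Q = AP_Q^Φ

module Sem {N : ℕ} (K : Kripke N) (Q : List ℕ) where
  open Kripke K

  IsPath : (ℕ → Fin N) → Set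
  IsPath π = ∀ i → E (π i) (π (suc i))

  Until : (Fin N → Set) → (Fin N → Set) → (ℕ → Fin N) → Set
  Until A B π = ∃[ i ] (B (π i) × (∀ j → j < i → A (π j)))

  EUntil AUntil : (Fin N → Set) → (Fin N → Set) → Fin N → Set
  EUntil A B x = ∃[ π ] (π 0 ≡ x × IsPath π × Until A B π)
  AUntil A B x = ∀ π → π 0 ≡ x → IsPath π → Until A B π

  sat : Env N → Fin N → Form → Set
  sat ε x (atom p) = (p ∈ Q × inEnv ε p x ≡ true) ⊎ (p ∉ Q × ℓ x p ≡ true)
  sat ε x (¬f φ) = ¬ sat ε x φ
  sat ε x (φ ∨f ψ) = sat ε x φ ⊎ sat ε x ψ
  sat ε x (φ ∧f ψ) = ¬ ((¬ sat ε x φ) ⊎ (¬ sat ε x ψ))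
  sat ε x (EX φ) = ∃[ y ] (E x y × sat ε y φ)
  sat ε x (AX φ) = ¬ (∃[ y ] (E x y × ¬ sat ε y φ))
  sat ε x (EF φ) = EUntil (λ _ → ⊤) (λ y → sat ε y φ) x
  sat ε x (AG φ) = ¬ EUntil (λ _ → ⊤) (λ y → ¬ sat ε y φ) x
  sat ε x (EU φ ψ) = EUntil (λ y → sat ε y φ) (λ y → sat ε y ψ) x
  sat ε x (AU φ ψ) = AUntil (λ y → sat ε y φ) (λ y → sat ε y ψ) x
  sat ε x (∃f p φ) = ∃[ S ] sat (ε [ p ↦ S ]) x φ

-- QBF over variables p^y, represented as pairs (p , y)

infixr 6 _∧q_
infixr 5 _∨q_

data QBF (N : ℕ) : Set where
  var       : ℕ → Fin N → QBF N
  ⊤q ⊥q     : QBF N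
  _∨q_ _∧q_ : QBF N → QBF N → QBF N
  ¬q_       : QBF N → QBF N
  ∃q        : ℕ → Fin N → QBF N → QBF N

Valuation : ℕ → Set
Valuation N = ℕ → Fin N → Bool

_[_,_≔_] : ∀ {N} → Valuation N → ℕ → Fin N → Bool → Valuation N
(v [ p , y ≔ b ]) q z = if (q ≡ᵇ p) ∧ does (z ≟F y) then b else v q z

evalQ : ∀ {N} → QBF N → Valuation N → Bool
evalQ (var p y) v = v p y
evalQ ⊤q v = true
evalQ ⊥q v = false
evalQ (α ∨q β) v = evalQ α v ∨ evalQ β v
evalQ (α ∧q β) v = evalQ α v ∧ evalQ β v
evalQ (¬q α) v = Data.Bool.not (evalQ α v)
evalQ (∃q p y α) v = evalQ α (v [ p , y ≔ true ]) ∨ evalQ α (v [ p , y ≔ false ])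

_⊨q_ : ∀ {N} → Valuation N → QBF N → Set
v ⊨q α = evalQ α v ≡ true

⋁ ⋀ : ∀ {N} → List (QBF N) → QBF N
⋁ = foldr _∨q_ ⊥q
⋀ = foldr _∧q_ ⊤q

-- v_ε : v_ε(p^y) = ⊤ iff y ∈ ε(p)  (and ⊥ for p ∉ dom ε, irrelevant)
valEnv : ∀ {N} → Env N → Valuation N
valEnv ε p y = inEnv ε p y

-- The translation  φ ↦ φ̂^{x,P}.  It needs to enumerate E*-successors,
-- so it is parameterised by a decision procedure for E* (= Star E).

module Trans {N : ℕ} (K : Kripke N)
             (star? : (x y : Fin N) → Dec (Star (Kripke.E K) x y)) where
  open Kripke K
  open DecMem (_≟F_ {N}) using (_∈?_)

  succs : Fin N → List (Fin N)
  succs x = filter (E? x) (allFin N)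

  reach : Fin N → List (Fin N)
  reach x = filter (star? x) (allFin N)

  -- \overline{E φ U ψ}^{x,P,X}; f y = φ̂^{y,P}, g y = ψ̂^{y,P}.
  -- Fuel k: each recursive call adds a new vertex to X, so starting with
  -- fuel N and X = {x} the fuel never runs out (the zero case, where
  -- X would contain N+1 distinct vertices, is unreachable).
  euB : ℕ → (Fin N → QBF N) → (Fin N → QBF N) → Fin N → List (Fin N) → QBF N
  euB zero    f g x X = g x ∨q (f x ∧q ⊥q)
  euB (suc k) f g x X =
    g x ∨q (f x ∧q ⋁ (map (λ x' → euB k f g x' (x' ∷ X))
                          (filter (λ x' → ¬? (x' ∈? X)) (succs x))))

  auB : ℕ → (Fin N → QBF N) → (Fin N → QBF N) → Fin N → List (Fin N) → QBF N
  auB zero    f g x X = g x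
  auB (suc k) f g x X =
    if any (λ x' → does (x' ∈? X)) (succs x)
    then g x
    else (g x ∨q (f x ∧q ⋀ (map (λ x' → auB k f g x' (x' ∷ X)) (succs x))))

  tr : Form → Fin N → (ℕ → Bool) → QBF N
  tr (atom p) x P = if P p then var p x else (if ℓ x p then ⊤q else ⊥q)
  tr (¬f φ) x P = ¬q tr φ x P
  tr (φ ∨f ψ) x P = tr φ x P ∨q tr ψ x P
  tr (φ ∧f ψ) x P = tr φ x P ∧q tr ψ x P
  tr (EX φ) x P = ⋁ (map (λ x' → tr φ x' P) (succs x))
  tr (AX φ) x P = ⋀ (map (λ x' → tr φ x' P) (succs x))
  tr (EF φ) x P = ⋁ (map (λ x' → tr φ x' P) (reach x))
  tr (AG φ) x P = ⋀ (map (λ x' → tr φ x' P) (reach x))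
  tr (EU φ ψ) x P = euB N (λ y → tr φ y P) (λ y → tr ψ y P) x (x ∷ [])
  tr (AU φ ψ) x P = auB N (λ y → tr φ y P) (λ y → tr ψ y P) x (x ∷ [])
  tr (∃f p φ) x P =
    foldr (λ y α → ∃q p y α) (tr φ x (λ q → P q ∨ (q ≡ᵇ p))) (allFin N)

module Submission where

-- Generalise over every environment ε together with a set P of
-- propositions and a valuation v that agree pointwise with dom ε and v_ε, and
-- induct on φ.  Boolean connectives and EX, AX, EF, AG are finite disjunctions and
-- conjunctions over the successors or the reachable vertices; ∃ p is a
-- disjunction over all 2^|V| assignments to the variables p^y.  For E φ U ψ, a
-- finite witness can be shortened until it visits no vertex twice, and the bounded
-- unfolding with visited set X then finds it.  For A φ U ψ, if the unfolding fails
-- then either a vertex violating both φ and ψ is met, or a successor returns to X,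
-- which closes a cycle of ¬ψ-vertices: in both cases some infinite path never
-- satisfies φ U ψ.  The semantics is classical, but each sat ε x φ is decidable by
-- the induction hypothesis, being equivalent to the truth of a Boolean.

open import Defs
open import Level using (0ℓ)
open import Data.Nat as ℕ using (ℕ; zero; suc; _≤_; _<_; _+_; s≤s; z<s; s<s; _≡ᵇ_)
open import Data.Nat.Properties using (≤⇒≯; <⇒≤; +-identityʳ; +-suc; n<1+n)
open import Data.Fin using (Fin)
open import Data.Fin.Properties using (injective⇒≤; ¬∀⟶∃¬) renaming (_≟_ to _≟F_)
open import Data.Bool as Bool using (Bool; true; false; T; _∨_; _∧_; not; if_then_else_)
open import Data.Bool.Properties using (∨-zeroʳ; ∨-identityʳ)
open import Data.Bool.ListAction using (any)
open import Data.Maybe using (nothing; is-just)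
open import Data.Unit using (⊤; tt)
open import Data.Empty using (⊥; ⊥-elim)
open import Data.Product using (Σ; Σ-syntax; ∃-syntax; _×_; _,_; proj₁; proj₂; uncurry)
open import Data.Product.Function.NonDependent.Propositional using (_×-⇔_)
open import Data.Sum using (_⊎_; inj₁; inj₂; [_,_])
open import Data.Sum.Function.Propositional using (_⊎-⇔_)
open import Data.List using (List; []; _∷_; length; lookup; map; filter; foldr; allFin)
open import Data.List.Membership.Propositional using (_∈_; _∉_; find; lose)
open import Data.List.Membership.Propositional.Properties
  using (∈-lookup; ∈-allFin; ∈-filter⁺; ∈-filter⁻; ∈-++⁺ˡ; ∈-++⁺ʳ)
import Data.List.Membership.DecPropositional as DecMembership
open import Data.List.Relation.Binary.Subset.Propositional using (_⊆_)
open import Data.List.Relation.Unary.Any as Any using (Any; here; there)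
open import Data.List.Relation.Unary.Any.Properties using (∷↔; any⇔)
open import Data.List.Relation.Unary.All as All using (All; []; _∷_)
open import Data.List.Relation.Unary.All.Properties using (¬Any⇒All¬)
open import Data.List.Relation.Unary.AllPairs using ([]; _∷_)
open import Data.List.Relation.Unary.Unique.Propositional using (Unique)
open import Function using (_∘_; id; const)
open import Function.Bundles using (_⇔_; mk⇔; Equivalence)
open import Function.Properties.Inverse using (↔⇒⇔)
import Function.Properties.Equivalence as ⇔
open import Function.Related.TypeIsomorphisms using (¬-cong-⇔)
open import Relation.Unary using (Decidable)
open import Relation.Nullary using (¬_; Dec; yes; no; ¬?; does; contradiction)
open import Relation.Nullary.Decidable as Dec using (T?; dec-true; dec-false; decidable-stable; _→-dec_)
open import Relation.Binary.PropositionalEquality using (_≡_; _≢_; refl; sym; trans; subst; cong; cong₂)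
open import Relation.Binary.Construct.Closure.ReflexiveTransitive as Star using (Star; _◅_; _◅◅_)
open import Relation.Binary.Reasoning.Setoid (⇔.⇔-setoid 0ℓ)

open Equivalence using (to; from)

-- Finite enumerations and decidable logic

lookup-injective : ∀ {A : Set} {xs : List A} → Unique xs →
                   ∀ i j → lookup xs i ≡ lookup xs j → i ≡ j
lookup-injective (_ ∷ _)         Fin.zero    Fin.zero    _  = refl
lookup-injective (x∉xs ∷ _)      Fin.zero    (Fin.suc j) eq = ⊥-elim (All.lookup x∉xs (∈-lookup j) eq)
lookup-injective (x∉xs ∷ _)      (Fin.suc i) Fin.zero    eq = ⊥-elim (All.lookup x∉xs (∈-lookup i) (sym eq))
lookup-injective (_ ∷ unique)    (Fin.suc i) (Fin.suc j) eq = cong Fin.suc (lookup-injective unique i j eq)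

Unique⇒length≤ : ∀ {N} {xs : List (Fin N)} → Unique xs → length xs ≤ N
Unique⇒length≤ unique = injective⇒≤ (lookup-injective unique _ _)

module _ {N : ℕ} {P : Fin N → Set} (P? : Decidable P) where

  ∈-filter-allFin : ∀ {y} → y ∈ filter P? (allFin N) ⇔ P y
  ∈-filter-allFin = mk⇔ (proj₂ ∘ ∈-filter⁻ P? {xs = allFin N}) (∈-filter⁺ P? (∈-allFin _))

  Any-filter-allFin : ∀ {A : Fin N → Set} → Any A (filter P? (allFin N)) ⇔ (∃[ y ] (P y × A y))
  Any-filter-allFin = mk⇔
    (λ any → let (y , y∈ , a) = find any in y , to ∈-filter-allFin y∈ , a)
    (λ (y , py , a) → lose (from ∈-filter-allFin py) a)

  All-filter-allFin : ∀ {A : Fin N → Set} → All A (filter P? (allFin N)) ⇔ (∀ y → P y → A y)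
  All-filter-allFin = mk⇔
    (λ all y py → All.lookup all (from ∈-filter-allFin py))
    (λ a → All.tabulate (λ y∈ → a _ (to ∈-filter-allFin y∈)))

¬∃¬⇔∀ : ∀ {A : Set} {P Q : A → Set} → (∀ a → Dec (Q a)) →
        (¬ (∃[ a ] (P a × ¬ Q a))) ⇔ (∀ a → P a → Q a)
¬∃¬⇔∀ Q? = mk⇔ (λ ¬∃ a pa → decidable-stable (Q? a) (λ ¬qa → ¬∃ (a , pa , ¬qa)))
               (λ ∀q (a , pa , ¬qa) → ¬qa (∀q a pa))

¬[¬⊎¬]⇔× : ∀ {A B : Set} → Dec A → Dec B → (¬ (¬ A ⊎ ¬ B)) ⇔ (A × B)
¬[¬⊎¬]⇔× A? B? = mk⇔ (λ ¬[¬a⊎¬b] → decidable-stable A? (¬[¬a⊎¬b] ∘ inj₁) , decidable-stable B? (¬[¬a⊎¬b] ∘ inj₂))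
                     (λ { (a , b) (inj₁ ¬a) → ¬a a ; (a , b) (inj₂ ¬b) → ¬b b })

module _ {N : ℕ} {D P : Fin N → Set} (D? : Decidable D) (P? : Decidable P) where

  ¬∀⇒∃¬ : ¬ (∀ y → D y → P y) → ∃[ y ] (D y × ¬ P y)
  ¬∀⇒∃¬ ¬∀ with ¬∀⟶∃¬ N (λ y → D y → P y) (λ y → D? y →-dec P? y) ¬∀
  ... | y , ¬[D→P] = y , decidable-stable (D? y) (λ ¬d → ¬[D→P] (⊥-elim ∘ ¬d)) , ¬[D→P] ∘ const

T-does : ∀ {A : Set} (a? : Dec A) → T (does a?) ⇔ A
T-does (yes a) = mk⇔ (λ _ → a) (λ _ → _)
T-does (no ¬a) = mk⇔ (λ ()) ¬a

-- Truth of QBF formulas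

∨-≡-true : ∀ a {b} → (a ∨ b ≡ true) ⇔ (a ≡ true ⊎ b ≡ true)
∨-≡-true true  = mk⇔ (λ _ → inj₁ refl) (λ _ → refl)
∨-≡-true false = mk⇔ inj₂ λ { (inj₁ ()) ; (inj₂ b) → b }

∧-≡-true : ∀ a {b} → (a ∧ b ≡ true) ⇔ (a ≡ true × b ≡ true)
∧-≡-true true  = mk⇔ (refl ,_) (λ (_ , b) → b)
∧-≡-true false = mk⇔ (λ ()) λ { (() , _) }

not-≡-true : ∀ a → (not a ≡ true) ⇔ (¬ a ≡ true)
not-≡-true true  = mk⇔ (λ ()) (λ ¬t → ⊥-elim (¬t refl))
not-≡-true false = mk⇔ (λ _ ()) (λ _ → refl)

⊨-∨q : ∀ {N} {v : Valuation N} α β → v ⊨q (α ∨q β) ⇔ (v ⊨q α ⊎ v ⊨q β)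
⊨-∨q {v = v} α β = ∨-≡-true (evalQ α v)

⊨-∧q : ∀ {N} {v : Valuation N} α β → v ⊨q (α ∧q β) ⇔ (v ⊨q α × v ⊨q β)
⊨-∧q {v = v} α β = ∧-≡-true (evalQ α v)

⊨-¬q : ∀ {N} {v : Valuation N} α → v ⊨q (¬q α) ⇔ (¬ v ⊨q α)
⊨-¬q {v = v} α = not-≡-true (evalQ α v)

⊭⊥q : ∀ {N} {v : Valuation N} → ¬ v ⊨q ⊥q
⊭⊥q ()

_⊨q?_ : ∀ {N} (v : Valuation N) α → Dec (v ⊨q α)
v ⊨q? α = evalQ α v Bool.≟ true

⇔⊨q⇒Dec : ∀ {N} {v : Valuation N} {A : Set} α → A ⇔ v ⊨q α → Dec A
⇔⊨q⇒Dec {v = v} α A⇔α = Dec.map (⇔.sym A⇔α) (v ⊨q? α)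

module _ {N : ℕ} {v : Valuation N} {A : Fin N → Set} {h : Fin N → QBF N}
         (A⇔h : ∀ y → A y ⇔ v ⊨q h y) where

  Any⇔⊨⋁ : ∀ ys → Any A ys ⇔ v ⊨q ⋁ (map h ys)
  Any⇔⊨⋁ []       = mk⇔ (λ ()) (λ ())
  Any⇔⊨⋁ (y ∷ ys) = ⇔.trans (⇔.sym (↔⇒⇔ (∷↔ A)))
                     (⇔.trans (A⇔h y ⊎-⇔ Any⇔⊨⋁ ys) (⇔.sym (⊨-∨q (h y) (⋁ (map h ys)))))

  All⇔⊨⋀ : ∀ ys → All A ys ⇔ v ⊨q ⋀ (map h ys)
  All⇔⊨⋀ []       = mk⇔ (λ _ → refl) (λ _ → [])
  All⇔⊨⋀ (y ∷ ys) = ⇔.trans (mk⇔ All.uncons (uncurry _∷_))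
                     (⇔.trans (A⇔h y ×-⇔ All⇔⊨⋀ ys) (⇔.sym (⊨-∧q (h y) (⋀ (map h ys)))))

⊨-if : ∀ {N} {v : Valuation N} b → v ⊨q (if b then ⊤q else ⊥q) ⇔ (b ≡ true)
⊨-if true  = ⇔.refl
⊨-if false = ⇔.refl

-- Valuations and environments

-- does (q ℕ.≟ p) computes to q ≡ᵇ p.
≡ᵇ-≢ : ∀ {q p} → q ≢ p → (q ≡ᵇ p) ≡ false
≡ᵇ-≢ {q} {p} = dec-false (q ℕ.≟ p)

evalQ-cong : ∀ {N} (α : QBF N) {v w : Valuation N} →
             (∀ q z → v q z ≡ w q z) → evalQ α v ≡ evalQ α w
evalQ-cong (var p y)   v≗w = v≗w p y
evalQ-cong ⊤q          v≗w = refl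
evalQ-cong ⊥q          v≗w = refl
evalQ-cong (α ∨q β)    v≗w = cong₂ _∨_ (evalQ-cong α v≗w) (evalQ-cong β v≗w)
evalQ-cong (α ∧q β)    v≗w = cong₂ _∧_ (evalQ-cong α v≗w) (evalQ-cong β v≗w)
evalQ-cong (¬q α)      v≗w = cong not (evalQ-cong α v≗w)
evalQ-cong (∃q p y α) {v} {w} v≗w =
  cong₂ _∨_ (evalQ-cong α (update-cong true)) (evalQ-cong α (update-cong false))
  where
  update-cong : ∀ b q z → (v [ p , y ≔ b ]) q z ≡ (w [ p , y ≔ b ]) q z
  update-cong b q z with (q ≡ᵇ p) ∧ does (z ≟F y)
  ... | true  = refl
  ... | false = v≗w q z

module _ {N : ℕ} (v : Valuation N) (p : ℕ) (y : Fin N) (b : Bool) where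

  update-same : (v [ p , y ≔ b ]) p y ≡ b
  update-same rewrite dec-true (p ℕ.≟ p) refl | dec-true (y ≟F y) refl = refl

  update-other-prop : ∀ {q} → q ≢ p → ∀ z → (v [ p , y ≔ b ]) q z ≡ v q z
  update-other-prop q≢p z rewrite ≡ᵇ-≢ q≢p = refl

  update-other-vertex : ∀ q {z} → z ≢ y → (v [ p , y ≔ b ]) q z ≡ v q z
  update-other-vertex q {z} z≢y rewrite dec-false (z ≟F y) z≢y with q ≡ᵇ p
  ... | true  = refl
  ... | false = refl

_≗_off_ : ∀ {N} → Valuation N → Valuation N → ℕ → Set
w ≗ v off p = ∀ q → q ≢ p → ∀ z → w q z ≡ v q z

⊨∃q : ∀ {N} {v : Valuation N} p y α → v ⊨q ∃q p y α ⇔ (∃[ b ] (v [ p , y ≔ b ]) ⊨q α)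
⊨∃q p y α = ⇔.trans (∨-≡-true _) (mk⇔ (λ { (inj₁ ⊨α) → true , ⊨α ; (inj₂ ⊨α) → false , ⊨α })
                                       (λ { (true , ⊨α) → inj₁ ⊨α ; (false , ⊨α) → inj₂ ⊨α }))

∃q* : ∀ {N} → ℕ → List (Fin N) → QBF N → QBF N
∃q* p ys α = foldr (λ y β → ∃q p y β) α ys

module _ {N : ℕ} (p : ℕ) (α : QBF N) where

  ⊨∃q*⁻ : ∀ ys {v} → v ⊨q ∃q* p ys α → ∃[ w ] (w ≗ v off p × w ⊨q α)
  ⊨∃q*⁻ []       {v} ⊨α = v , (λ _ _ _ → refl) , ⊨α
  ⊨∃q*⁻ (y ∷ ys) {v} ⊨∃ with to (⊨∃q p y (∃q* p ys α)) ⊨∃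
  ... | b , ⊨∃′ with ⊨∃q*⁻ ys ⊨∃′
  ... | w , w≗v′ , ⊨α = w , (λ q q≢p z → trans (w≗v′ q q≢p z) (update-other-prop v p y b q≢p z)) , ⊨α

  ⊨∃q*⁺ : ∀ ys {v w} → w ≗ v off p → (∀ z → z ∉ ys → w p z ≡ v p z) →
          w ⊨q α → v ⊨q ∃q* p ys α
  ⊨∃q*⁺ [] {v} {w} w≗v w≗v-at-p ⊨α = trans (evalQ-cong α (λ q z → sym (w≗v-everywhere q z))) ⊨α
    where
    w≗v-everywhere : ∀ q z → w q z ≡ v q z
    w≗v-everywhere q z with q ℕ.≟ p
    ... | yes refl = w≗v-at-p z (λ ())
    ... | no q≢p   = w≗v q q≢p z
  ⊨∃q*⁺ (y ∷ ys) {v} {w} w≗v w≗v-at-p ⊨α =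
    from (⊨∃q p y (∃q* p ys α)) (w p y , ⊨∃q*⁺ ys w≗v′ w≗v′-at-p ⊨α)
    where
    v′ : Valuation N
    v′ = v [ p , y ≔ w p y ]
    w≗v′ : w ≗ v′ off p
    w≗v′ q q≢p z = trans (w≗v q q≢p z) (sym (update-other-prop v p y (w p y) q≢p z))
    w≗v′-at-p : ∀ z → z ∉ ys → w p z ≡ v′ p z
    w≗v′-at-p z z∉ys = by-cases (z ≟F y)
      where
      by-cases : Dec (z ≡ y) → w p z ≡ v′ p z
      by-cases (yes refl) = sym (update-same v p y (w p y))
      by-cases (no z≢y)   = trans (w≗v-at-p z λ { (here z≡y) → z≢y z≡y ; (there z∈ys) → z∉ys z∈ys })
                                  (sym (update-other-vertex v p y (w p y) p z≢y))

  ⊨∃q*-allFin : ∀ {v} → v ⊨q ∃q* p (allFin N) α ⇔ (∃[ w ] (w ≗ v off p × w ⊨q α))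
  ⊨∃q*-allFin = mk⇔ (⊨∃q*⁻ (allFin N))
                    (λ (w , w≗v , ⊨α) → ⊨∃q*⁺ (allFin N) w≗v (λ z z∉ → ⊥-elim (z∉ (∈-allFin z))) ⊨α)

module _ {N : ℕ} (ε : Env N) (p : ℕ) (S : Fin N → Bool) where

  valEnv-update-same : ∀ z → valEnv (ε [ p ↦ S ]) p z ≡ S z
  valEnv-update-same z rewrite dec-true (p ℕ.≟ p) refl = refl

  valEnv-update-other : ∀ {q} → q ≢ p → ∀ z → valEnv (ε [ p ↦ S ]) q z ≡ valEnv ε q z
  valEnv-update-other q≢p z rewrite ≡ᵇ-≢ q≢p = refl

  dom-update : ∀ {P : ℕ → Bool} → (∀ q → P q ≡ dom ε q) → ∀ q → (P q ∨ (q ≡ᵇ p)) ≡ dom (ε [ p ↦ S ]) q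
  dom-update {P} P≗dom q with q ≡ᵇ p
  ... | true  = ∨-zeroʳ (P q)
  ... | false = trans (∨-identityʳ (P q)) (P≗dom q)

inEnv-outside-dom : ∀ {N} (ε : Env N) {p} → dom ε p ≡ false → ∀ x → inEnv ε p x ≡ false
inEnv-outside-dom ε {p} p∉dom x with ε p
... | nothing = refl

-- Correctness of the translation

module Correctness {N : ℕ} (K : Kripke N)
                   (star? : (x y : Fin N) → Dec (Star (Kripke.E K) x y)) (Q : List ℕ) where
  open Kripke K
  open Sem K Q
  open Trans K star?
  open DecMembership (_≟F_ {N}) using (_∈?_)
  open DecMembership ℕ._≟_ using () renaming (_∈?_ to _∈ℕ?_)

  path-within : (S : Fin N → Set) → (∀ y → S y → ∃[ z ] (E y z × S z)) →
                ∀ {x} → S x → ∃[ π ] (π 0 ≡ x × IsPath π × (∀ i → S (π i)))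
  path-within S step {x} sx = proj₁ ∘ walk , refl , (λ i → proj₁ (proj₂ (next (walk i)))) , proj₂ ∘ walk
    where
    next : (s : Σ (Fin N) S) → ∃[ z ] (E (proj₁ s) z × S z)
    next (y , sy) = step y sy
    walk : ℕ → Σ (Fin N) S
    walk zero    = x , sx
    walk (suc i) = proj₁ (next (walk i)) , proj₂ (proj₂ (next (walk i)))

  serial-path : ∀ x → ∃[ π ] (π 0 ≡ x × IsPath π)
  serial-path x = let (π , π0 , path , _) = path-within (λ _ → ⊤) (λ y _ → proj₁ (serial y) , proj₂ (serial y) , tt) tt
                  in π , π0 , path

  _◃_ : Fin N → (ℕ → Fin N) → ℕ → Fin N
  (x ◃ π) zero    = x
  (x ◃ π) (suc i) = π i

  ◃-path : ∀ {x π} → E x (π 0) → IsPath π → IsPath (x ◃ π)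
  ◃-path e path zero    = e
  ◃-path e path (suc i) = path i

  T-any-∈⇔ : ∀ x X → T (any (λ y → does (y ∈? X)) (succs x)) ⇔ (∃[ y ] (E x y × y ∈ X))
  T-any-∈⇔ x X = ⇔.trans (⇔.sym any⇔)
                   (⇔.trans (mk⇔ (Any.map (to (T-does (_ ∈? X)))) (Any.map (from (T-does (_ ∈? X)))))
                            (Any-filter-allFin (E? x)))

  revisits? : ∀ x X → Dec (∃[ y ] (E x y × y ∈ X))
  revisits? x X = Dec.map (T-any-∈⇔ x X) (T? _)

  data Reaches (A B : Fin N → Set) : Fin N → Set where
    done : ∀ {x} → B x → Reaches A B x
    step : ∀ {x y} → A x → E x y → Reaches A B y → Reaches A B x

  module _ {A B : Fin N → Set} where

    Until-now : ∀ {π} → B (π 0) → Until A B π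
    Until-now b = 0 , b , λ _ ()

    Until-step : ∀ {π} → A (π 0) → Until A B (π ∘ suc) → Until A B π
    Until-step a (i , b , before) = suc i , b , λ { zero _ → a ; (suc j) (s<s j<i) → before j j<i }

    Until-tail : ∀ {π} → ¬ B (π 0) → Until A B π → Until A B (π ∘ suc)
    Until-tail ¬b (zero , b , _)        = ⊥-elim (¬b b)
    Until-tail ¬b (suc i , b , before) = i , b , λ j j<i → before (suc j) (s<s j<i)

    Until⇒Reaches : ∀ π → IsPath π → ∀ i → B (π i) → (∀ j → j < i → A (π j)) → Reaches A B (π 0)
    Until⇒Reaches π path zero    b before = done b
    Until⇒Reaches π path (suc i) b before =
      step (before 0 z<s) (path 0) (Until⇒Reaches (π ∘ suc) (path ∘ suc) i b (λ j j<i → before (suc j) (s<s j<i)))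

    Reaches⇒EUntil : ∀ {x} → Reaches A B x → EUntil A B x
    Reaches⇒EUntil {x} (done b) = let (π , π0 , path) = serial-path x in π , π0 , path , Until-now b
    Reaches⇒EUntil {x} (step a e r) with Reaches⇒EUntil r
    ... | π , refl , path , until = x ◃ π , refl , ◃-path e path , Until-step a until

    EUntil⇔Reaches : ∀ {x} → EUntil A B x ⇔ Reaches A B x
    EUntil⇔Reaches = mk⇔ (λ { (π , refl , path , i , b , before) → Until⇒Reaches π path i b before }) Reaches⇒EUntil

    Escapes : Fin N → Set
    Escapes x = ∃[ π ] (π 0 ≡ x × IsPath π × ¬ Until A B π)

    _↝_ : Fin N → Fin N → Set
    _↝_ = Star (λ y z → ¬ B y × E y z)

    lasso : ∀ {x x′} → ¬ B x → E x x′ → x′ ↝ x → Escapes x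
    lasso {x} {x′} ¬b e x′↝x =
      let (π , π0 , path , ↝x) = path-within (_↝ x) next Star.ε
      in π , π0 , path , λ (i , b , _) → ¬B-before (↝x i) b
      where
      next : ∀ y → y ↝ x → ∃[ z ] (E y z × z ↝ x)
      next y Star.ε            = x′ , e , x′↝x
      next y ((_ , e′) ◅ z↝x) = _ , e′ , z↝x
      ¬B-before : ∀ {y} → y ↝ x → ¬ B y
      ¬B-before Star.ε          = ¬b
      ¬B-before ((¬b′ , _) ◅ _) = ¬b′

    module _ {v : Valuation N} {f g : Fin N → QBF N}
             (A⇔f : ∀ y → A y ⇔ v ⊨q f y) (B⇔g : ∀ y → B y ⇔ v ⊨q g y) where

      ⊨euB-zero : ∀ x X → v ⊨q euB zero f g x X ⇔ B x
      ⊨euB-zero x X = begin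
        v ⊨q euB zero f g x X           ≈⟨ ⊨-∨q (g x) (f x ∧q ⊥q) ⟩
        (v ⊨q g x ⊎ v ⊨q (f x ∧q ⊥q))  ≈⟨ B⇔g x ⊎-⇔ mk⇔ (λ ()) (⊭⊥q {v = v} ∘ proj₂ ∘ to (⊨-∧q (f x) ⊥q)) ⟨
        (B x ⊎ ⊥)                       ≈⟨ mk⇔ [ id , ⊥-elim ] inj₁ ⟩
        B x                              ∎

      ⊨euB-suc : ∀ k x X → v ⊨q euB (suc k) f g x X ⇔
                 (B x ⊎ (A x × ∃[ y ] ((E x y × y ∉ X) × v ⊨q euB k f g y (y ∷ X))))
      ⊨euB-suc k x X = begin
        v ⊨q euB (suc k) f g x X                                        ≈⟨ ⊨-∨q (g x) (f x ∧q ⋁ (map next fresh)) ⟩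
        (v ⊨q g x ⊎ v ⊨q (f x ∧q ⋁ (map next fresh)))                  ≈⟨ ⇔.refl ⊎-⇔ ⊨-∧q (f x) (⋁ (map next fresh)) ⟩
        (v ⊨q g x ⊎ (v ⊨q f x × v ⊨q ⋁ (map next fresh)))              ≈⟨ B⇔g x ⊎-⇔ (A⇔f x ×-⇔ Any⇔⊨⋁ (λ _ → ⇔.refl) fresh) ⟨
        (B x ⊎ (A x × Any (λ y → v ⊨q next y) fresh))                   ≈⟨ ⇔.refl ⊎-⇔ (⇔.refl ×-⇔ Any-fresh) ⟩
        (B x ⊎ (A x × ∃[ y ] ((E x y × y ∉ X) × v ⊨q next y)))         ∎
        where
        next : Fin N → QBF N
        next y = euB k f g y (y ∷ X)
        fresh : List (Fin N)
        fresh = filter (λ y → ¬? (y ∈? X)) (succs x)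
        Any-fresh : Any (λ y → v ⊨q next y) fresh ⇔ (∃[ y ] ((E x y × y ∉ X) × v ⊨q next y))
        Any-fresh = mk⇔
          (λ any → let (y , y∈ , ⊨) = find any
                       (y∈succs , y∉X) = ∈-filter⁻ (λ y → ¬? (y ∈? X)) {xs = succs x} y∈
                   in y , (to (∈-filter-allFin (E? x)) y∈succs , y∉X) , ⊨)
          (λ (y , (e , y∉X) , ⊨) →
             lose (∈-filter⁺ (λ y → ¬? (y ∈? X)) (from (∈-filter-allFin (E? x)) e) y∉X) ⊨)

      euB-sound : ∀ k x X → v ⊨q euB k f g x X → Reaches A B x
      euB-sound zero    x X ⊨eu = done (to (⊨euB-zero x X) ⊨eu)
      euB-sound (suc k) x X ⊨eu with to (⊨euB-suc k x X) ⊨eu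
      ... | inj₁ b                          = done b
      ... | inj₂ (a , y , (e , _) , ⊨eu′) = step a e (euB-sound k y (y ∷ X) ⊨eu′)

      later : ∀ {x} → Reaches A B x → List (Fin N)
      later (done _)             = []
      later (step {y = y} _ _ r) = y ∷ later r

      Simple : ∀ {x} → Reaches A B x → Set
      Simple {x} r = Unique (x ∷ later r)

      suffix : ∀ {x z} (r : Reaches A B x) → Simple r → z ∈ x ∷ later r → Σ[ r′ ∈ Reaches A B z ] Simple r′
      suffix r            simple      (here refl) = r , simple
      suffix (step _ _ r) (_ ∷ simple) (there z∈) = suffix r simple z∈

      simplify : ∀ {x} → Reaches A B x → Σ[ r ∈ Reaches A B x ] Simple r
      simplify (done b) = done b , [] ∷ []
      simplify {x} (step a e r) with simplify r
      ... | r′ , simple with x ∈? (_ ∷ later r′)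
      ...   | yes x∈ = suffix r′ simple x∈
      ...   | no x∉  = step a e r′ , ¬Any⇒All¬ _ x∉ ∷ simple

      euB-complete : ∀ k {x} X (r : Reaches A B x) → Simple r → All (_∉ X) (later r) →
                     length (later r) ≤ k → v ⊨q euB k f g x X
      euB-complete zero    X (done b) _ _ _ = from (⊨euB-zero _ X) b
      euB-complete (suc k) X (done b) _ _ _ = from (⊨euB-suc k _ X) (inj₁ b)
      euB-complete (suc k) X (step {y = y} a e r) (_ ∷ simple@(y≢later ∷ _)) (y∉X ∷ later∉X) (s≤s length≤k) =
        from (⊨euB-suc k _ X)
          (inj₂ (a , y , (e , y∉X) , euB-complete k (y ∷ X) r simple later∉y∷X length≤k))
        where
        later∉y∷X : All (_∉ y ∷ X) (later r)
        later∉y∷X = All.zipWith (λ { (y≢z , z∉X) (here z≡y) → y≢z (sym z≡y) ; (y≢z , z∉X) (there z∈X) → z∉X z∈X })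
                                (y≢later , later∉X)

      EU⇔⊨euB : ∀ x → EUntil A B x ⇔ v ⊨q euB N f g x (x ∷ [])
      EU⇔⊨euB x = ⇔.trans EUntil⇔Reaches (mk⇔ complete (euB-sound N x (x ∷ [])))
        where
        complete : Reaches A B x → v ⊨q euB N f g x (x ∷ [])
        complete r with simplify r
        ... | r′ , simple@(x≢later ∷ _) =
          euB-complete N (x ∷ []) r′ simple (All.map (λ { x≢z (here z≡x) → x≢z (sym z≡x) }) x≢later)
                       (<⇒≤ (Unique⇒length≤ simple))

      ⊨auB-revisit : ∀ k x X → ∃[ y ] (E x y × y ∈ X) → v ⊨q auB (suc k) f g x X ⇔ B x
      ⊨auB-revisit k x X revisit with any (λ y → does (y ∈? X)) (succs x) in any≡
      ... | true  = ⇔.sym (B⇔g x)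
      ... | false = ⊥-elim (subst T any≡ (from (T-any-∈⇔ x X) revisit))

      ⊨auB-fresh : ∀ k x X → ¬ (∃[ y ] (E x y × y ∈ X)) → v ⊨q auB (suc k) f g x X ⇔
                   (B x ⊎ (A x × ∀ y → E x y → v ⊨q auB k f g y (y ∷ X)))
      ⊨auB-fresh k x X ¬revisit with any (λ y → does (y ∈? X)) (succs x) in any≡
      ... | true  = ⊥-elim (¬revisit (to (T-any-∈⇔ x X) (subst T (sym any≡) _)))
      ... | false = begin
        v ⊨q (g x ∨q (f x ∧q ⋀ (map next (succs x))))                ≈⟨ ⊨-∨q (g x) (f x ∧q ⋀ (map next (succs x))) ⟩
        (v ⊨q g x ⊎ v ⊨q (f x ∧q ⋀ (map next (succs x))))            ≈⟨ ⇔.refl ⊎-⇔ ⊨-∧q (f x) (⋀ (map next (succs x))) ⟩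
        (v ⊨q g x ⊎ (v ⊨q f x × v ⊨q ⋀ (map next (succs x))))        ≈⟨ B⇔g x ⊎-⇔ (A⇔f x ×-⇔ All⇔⊨⋀ (λ _ → ⇔.refl) (succs x)) ⟨
        (B x ⊎ (A x × All (λ y → v ⊨q next y) (succs x)))             ≈⟨ ⇔.refl ⊎-⇔ (⇔.refl ×-⇔ All-filter-allFin (E? x)) ⟩
        (B x ⊎ (A x × ∀ y → E x y → v ⊨q next y))                    ∎
        where
        next : Fin N → QBF N
        next y = auB k f g y (y ∷ X)

      auB-sound : ∀ k x X → v ⊨q auB k f g x X → AUntil A B x
      auB-sound zero    x X ⊨au π refl _ = Until-now (from (B⇔g x) ⊨au)
      auB-sound (suc k) x X ⊨au π refl path with revisits? x X
      ... | yes revisit = Until-now (to (⊨auB-revisit k x X revisit) ⊨au)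
      ... | no ¬revisit with to (⊨auB-fresh k x X ¬revisit) ⊨au
      ...   | inj₁ b           = Until-now b
      ...   | inj₂ (a , ⊨next) = Until-step a (auB-sound k (π 1) (π 1 ∷ X) (⊨next (π 1) (path 0)) (π ∘ suc) refl (path ∘ suc))

      -- Invariant: X is duplicate-free and each of its vertices leads to x through ¬B-vertices,
      -- so a successor in X closes a ¬B-cycle; N < length X + k excludes running out of fuel.
      auB-complete : ∀ k x X → Unique X → N < length X + k → (∀ {y} → y ∈ X → y ↝ x) →
                     ¬ v ⊨q auB k f g x X → Escapes x
      auB-complete zero x X unique fuel _ _ =
        ⊥-elim (≤⇒≯ (Unique⇒length≤ unique) (subst (N <_) (+-identityʳ _) fuel))
      auB-complete (suc k) x X unique fuel back ⊭au with revisits? x X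
      ... | yes revisit@(x′ , e , x′∈X) = lasso (⊭au ∘ from (⊨auB-revisit k x X revisit)) e (back x′∈X)
      ... | no ¬revisit = escape (⇔⊨q⇒Dec (f x) (A⇔f x))
        where
        ¬b : ¬ B x
        ¬b = ⊭au ∘ from (⊨auB-fresh k x X ¬revisit) ∘ inj₁
        extend : ∀ {x′} → E x x′ → Escapes x′ → Escapes x
        extend e (π , refl , path , ¬until) = x ◃ π , refl , ◃-path e path , ¬until ∘ Until-tail ¬b
        back′ : ∀ {x′} → E x x′ → ∀ {y} → y ∈ x′ ∷ X → y ↝ x′
        back′ e (here refl) = Star.ε
        back′ e (there y∈X) = back y∈X ◅◅ ((¬b , e) ◅ Star.ε)
        escape : Dec (A x) → Escapes x
        escape (no ¬a) = let (π , π0 , path) = serial-path x in π , π0 , path , λ where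
          (zero , b , _)        → ¬b (subst B π0 b)
          (suc i , _ , before) → ¬a (subst A π0 (before 0 z<s))
        escape (yes a) =
          let (x′ , e , ⊭au′) = ¬∀⇒∃¬ (E? x) (λ y → v ⊨q? auB k f g y (y ∷ X))
                                       (⊭au ∘ from (⊨auB-fresh k x X ¬revisit) ∘ inj₂ ∘ (a ,_))
              x′∉X = λ x′∈X → ¬revisit (x′ , e , x′∈X)
          in extend e (auB-complete k x′ (x′ ∷ X) (¬Any⇒All¬ X x′∉X ∷ unique)
                                    (subst (N <_) (+-suc (length X) k) fuel) (back′ e) ⊭au′)

      AU⇔⊨auB : ∀ x → AUntil A B x ⇔ v ⊨q auB N f g x (x ∷ [])
      AU⇔⊨auB x = mk⇔ complete (auB-sound N x (x ∷ []))
        where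
        complete : AUntil A B x → v ⊨q auB N f g x (x ∷ [])
        complete au = decidable-stable (v ⊨q? auB N f g x (x ∷ [])) λ ⊭au →
          let (π , π0 , path , ¬until) = auB-complete N x (x ∷ []) ([] ∷ []) (n<1+n N) (λ { (here refl) → Star.ε }) ⊭au
          in ¬until (au π π0 path)

  Reaches-⊤⇔Star : ∀ {B x} → Reaches (λ _ → ⊤) B x ⇔ (∃[ y ] (Star E x y × B y))
  Reaches-⊤⇔Star {B} = mk⇔ Reaches⇒Star Star⇒Reaches
    where
    Reaches⇒Star : ∀ {x} → Reaches (λ _ → ⊤) B x → ∃[ y ] (Star E x y × B y)
    Reaches⇒Star (done b)     = _ , Star.ε , b
    Reaches⇒Star (step _ e r) = let (y , x⇝y , b) = Reaches⇒Star r in y , e ◅ x⇝y , b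
    Star⇒Reaches : ∀ {x} → ∃[ y ] (Star E x y × B y) → Reaches (λ _ → ⊤) B x
    Star⇒Reaches (y , Star.ε , b)        = done b
    Star⇒Reaches (y , e ◅ x⇝y , b) = step tt e (Star⇒Reaches (y , x⇝y , b))

  module _ {v : Valuation N} {A : Fin N → Set} {f : Fin N → QBF N} (A⇔f : ∀ y → A y ⇔ v ⊨q f y) where

    private
      A? : ∀ y → Dec (A y)
      A? y = ⇔⊨q⇒Dec (f y) (A⇔f y)

    EX⇔⊨⋁ : ∀ x → (∃[ y ] (E x y × A y)) ⇔ v ⊨q ⋁ (map f (succs x))
    EX⇔⊨⋁ x = begin
      (∃[ y ] (E x y × A y))      ≈⟨ Any-filter-allFin (E? x) ⟨
      Any A (succs x)              ≈⟨ Any⇔⊨⋁ A⇔f (succs x) ⟩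
      v ⊨q ⋁ (map f (succs x))    ∎

    AX⇔⊨⋀ : ∀ x → (¬ (∃[ y ] (E x y × ¬ A y))) ⇔ v ⊨q ⋀ (map f (succs x))
    AX⇔⊨⋀ x = begin
      (¬ (∃[ y ] (E x y × ¬ A y)))  ≈⟨ ¬∃¬⇔∀ A? ⟩
      (∀ y → E x y → A y)            ≈⟨ All-filter-allFin (E? x) ⟨
      All A (succs x)                 ≈⟨ All⇔⊨⋀ A⇔f (succs x) ⟩
      v ⊨q ⋀ (map f (succs x))       ∎

    EF⇔⊨⋁ : ∀ x → EUntil (λ _ → ⊤) A x ⇔ v ⊨q ⋁ (map f (reach x))
    EF⇔⊨⋁ x = begin
      EUntil (λ _ → ⊤) A x          ≈⟨ EUntil⇔Reaches ⟩
      Reaches (λ _ → ⊤) A x         ≈⟨ Reaches-⊤⇔Star ⟩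
      (∃[ y ] (Star E x y × A y))   ≈⟨ Any-filter-allFin (star? x) ⟨
      Any A (reach x)                ≈⟨ Any⇔⊨⋁ A⇔f (reach x) ⟩
      v ⊨q ⋁ (map f (reach x))      ∎

    AG⇔⊨⋀ : ∀ x → (¬ EUntil (λ _ → ⊤) (λ y → ¬ A y) x) ⇔ v ⊨q ⋀ (map f (reach x))
    AG⇔⊨⋀ x = begin
      (¬ EUntil (λ _ → ⊤) (λ y → ¬ A y) x)   ≈⟨ ¬-cong-⇔ (⇔.trans EUntil⇔Reaches Reaches-⊤⇔Star) ⟩
      (¬ (∃[ y ] (Star E x y × ¬ A y)))       ≈⟨ ¬∃¬⇔∀ A? ⟩
      (∀ y → Star E x y → A y)                ≈⟨ All-filter-allFin (star? x) ⟨
      All A (reach x)                          ≈⟨ All⇔⊨⋀ A⇔f (reach x) ⟩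
      v ⊨q ⋀ (map f (reach x))                ∎

  -- Pointwise agreement suffices, and is all the ∃ case can provide without function extensionality.
  record Encodes (ε : Env N) (P : ℕ → Bool) (v : Valuation N) : Set where
    field
      dom-≡ : ∀ q → P q ≡ dom ε q
      val-≡ : ∀ q y → v q y ≡ valEnv ε q y
      dom⊆Q : ∀ q → T (dom ε q) → q ∈ Q

  Encodes-update : ∀ {ε P v w p S} → p ∈ Q → Encodes ε P v → w ≗ v off p → (∀ z → w p z ≡ S z) →
                   Encodes (ε [ p ↦ S ]) (λ q → P q ∨ (q ≡ᵇ p)) w
  Encodes-update {ε} {P} {v} {w} {p} {S} p∈Q enc w≗v w≡S = record
    { dom-≡ = dom-update ε p S dom-≡
    ; val-≡ = val-≡′
    ; dom⊆Q = dom⊆Q′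
    }
    where
    open Encodes enc
    val-≡′ : ∀ q z → w q z ≡ valEnv (ε [ p ↦ S ]) q z
    val-≡′ q z with q ℕ.≟ p
    ... | yes refl = trans (w≡S z) (sym (valEnv-update-same ε p S z))
    ... | no q≢p   = trans (w≗v q q≢p z) (trans (val-≡ q z) (sym (valEnv-update-other ε p S q≢p z)))
    dom⊆Q′ : ∀ q → T (dom (ε [ p ↦ S ]) q) → q ∈ Q
    dom⊆Q′ q q∈dom with q ℕ.≟ p
    ... | yes refl = p∈Q
    ... | no q≢p rewrite ≡ᵇ-≢ q≢p = dom⊆Q q q∈dom

  module _ (ℓ-free : ∀ p → p ∈ Q → ∀ y → ℓ y p ≡ false) where

    atom-correct : ∀ {ε P v} → Encodes ε P v → ∀ p x → sat ε x (atom p) ⇔ v ⊨q tr (atom p) x P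
    atom-correct {ε} {P} {v} enc p x with P p in Pp≡
    ... | true  = mk⇔ (λ { (inj₁ (_ , p∈ε)) → trans (val-≡ p x) p∈ε ; (inj₂ (p∉Q , _)) → ⊥-elim (p∉Q p∈Q) })
                      (λ ⊨p → inj₁ (p∈Q , trans (sym (val-≡ p x)) ⊨p))
      where
      open Encodes enc
      p∈Q : p ∈ Q
      p∈Q = dom⊆Q p (subst T (trans (sym Pp≡) (dom-≡ p)) _)
    ... | false = ⇔.trans (mk⇔ (λ { (inj₁ (_ , p∈ε)) → contradiction (trans (sym p∈ε) p∉ε) λ () ; (inj₂ (_ , ℓ≡)) → ℓ≡ })
                               free) (⇔.sym (⊨-if (ℓ x p)))
      where
      open Encodes enc
      p∉ε : inEnv ε p x ≡ false
      p∉ε = inEnv-outside-dom ε (trans (sym (dom-≡ p)) Pp≡) x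
      free : ℓ x p ≡ true → sat ε x (atom p)
      free ℓ≡ with p ∈ℕ? Q
      ... | yes p∈Q = contradiction (trans (sym ℓ≡) (ℓ-free p p∈Q x)) λ ()
      ... | no p∉Q  = inj₂ (p∉Q , ℓ≡)

    Correct : Form → Set
    Correct φ = ∀ {ε P v} → Encodes ε P v → ∀ x → sat ε x φ ⇔ v ⊨q tr φ x P

    ∃f-correct : ∀ {p φ} → p ∈ Q → Correct φ → Correct (∃f p φ)
    ∃f-correct {p} {φ} p∈Q φ-correct {ε} {P} {v} enc x = begin
      (∃[ S ] sat (ε [ p ↦ S ]) x φ)            ≈⟨ mk⇔ choose-valuation choose-set ⟩
      (∃[ w ] (w ≗ v off p × w ⊨q tr φ x P′))   ≈⟨ ⊨∃q*-allFin p (tr φ x P′) ⟨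
      v ⊨q tr (∃f p φ) x P                      ∎
      where
      open Encodes enc
      P′ : ℕ → Bool
      P′ q = P q ∨ (q ≡ᵇ p)
      choose-valuation : ∃[ S ] sat (ε [ p ↦ S ]) x φ → ∃[ w ] (w ≗ v off p × w ⊨q tr φ x P′)
      choose-valuation (S , sat-φ) = valEnv (ε [ p ↦ S ]) , w≗v , to (φ-correct enc′ x) sat-φ
        where
        w≗v : valEnv (ε [ p ↦ S ]) ≗ v off p
        w≗v q q≢p z = trans (valEnv-update-other ε p S q≢p z) (sym (val-≡ q z))
        enc′ = Encodes-update p∈Q enc w≗v (valEnv-update-same ε p S)
      choose-set : ∃[ w ] (w ≗ v off p × w ⊨q tr φ x P′) → ∃[ S ] sat (ε [ p ↦ S ]) x φ
      choose-set (w , w≗v , ⊨φ) = w p , from (φ-correct (Encodes-update p∈Q enc w≗v (λ _ → refl)) x) ⊨φ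

    tr-correct : ∀ φ → qprops φ ⊆ Q → Correct φ
    tr-correct (atom p)   _   enc = atom-correct enc p
    tr-correct (¬f φ)     φ⊆Q {P = P} enc x =
      ⇔.trans (¬-cong-⇔ (tr-correct φ φ⊆Q enc x)) (⇔.sym (⊨-¬q (tr φ x P)))
    tr-correct (φ ∨f ψ)   ⊆Q  {P = P} enc x =
      ⇔.trans (tr-correct φ (⊆Q ∘ ∈-++⁺ˡ) enc x ⊎-⇔ tr-correct ψ (⊆Q ∘ ∈-++⁺ʳ (qprops φ)) enc x)
              (⇔.sym (⊨-∨q (tr φ x P) (tr ψ x P)))
    tr-correct (φ ∧f ψ)   ⊆Q  {P = P} enc x =
      ⇔.trans (¬[¬⊎¬]⇔× (⇔⊨q⇒Dec (tr φ x P) φ-correct) (⇔⊨q⇒Dec (tr ψ x P) ψ-correct))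
              (⇔.trans (φ-correct ×-⇔ ψ-correct) (⇔.sym (⊨-∧q (tr φ x P) (tr ψ x P))))
      where
      φ-correct = tr-correct φ (⊆Q ∘ ∈-++⁺ˡ) enc x
      ψ-correct = tr-correct ψ (⊆Q ∘ ∈-++⁺ʳ (qprops φ)) enc x
    tr-correct (EX φ)     φ⊆Q enc = EX⇔⊨⋁ (tr-correct φ φ⊆Q enc)
    tr-correct (AX φ)     φ⊆Q enc = AX⇔⊨⋀ (tr-correct φ φ⊆Q enc)
    tr-correct (EF φ)     φ⊆Q enc = EF⇔⊨⋁ (tr-correct φ φ⊆Q enc)
    tr-correct (AG φ)     φ⊆Q enc = AG⇔⊨⋀ (tr-correct φ φ⊆Q enc)
    tr-correct (EU φ ψ)   ⊆Q  enc =
      EU⇔⊨euB (tr-correct φ (⊆Q ∘ ∈-++⁺ˡ) enc) (tr-correct ψ (⊆Q ∘ ∈-++⁺ʳ (qprops φ)) enc)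
    tr-correct (AU φ ψ)   ⊆Q  enc =
      AU⇔⊨auB (tr-correct φ (⊆Q ∘ ∈-++⁺ˡ) enc) (tr-correct ψ (⊆Q ∘ ∈-++⁺ʳ (qprops φ)) enc)
    tr-correct (∃f p φ)   ⊆Q      = ∃f-correct (⊆Q (here refl)) (tr-correct φ (⊆Q ∘ there))

⊑⇒qprops⊆ : ∀ {φ Φ} → φ ⊑ Φ → qprops φ ⊆ qprops Φ
⊑⇒qprops⊆ ⊑-refl         = id
⊑⇒qprops⊆ (⊑-¬ s)        = ⊑⇒qprops⊆ s
⊑⇒qprops⊆ (⊑-∨ˡ s)       = ∈-++⁺ˡ ∘ ⊑⇒qprops⊆ s
⊑⇒qprops⊆ (⊑-∨ʳ {ψ} s)   = ∈-++⁺ʳ (qprops ψ) ∘ ⊑⇒qprops⊆ s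
⊑⇒qprops⊆ (⊑-∧ˡ s)       = ∈-++⁺ˡ ∘ ⊑⇒qprops⊆ s
⊑⇒qprops⊆ (⊑-∧ʳ {ψ} s)   = ∈-++⁺ʳ (qprops ψ) ∘ ⊑⇒qprops⊆ s
⊑⇒qprops⊆ (⊑-EX s)       = ⊑⇒qprops⊆ s
⊑⇒qprops⊆ (⊑-AX s)       = ⊑⇒qprops⊆ s
⊑⇒qprops⊆ (⊑-EF s)       = ⊑⇒qprops⊆ s
⊑⇒qprops⊆ (⊑-AG s)       = ⊑⇒qprops⊆ s
⊑⇒qprops⊆ (⊑-EUˡ s)      = ∈-++⁺ˡ ∘ ⊑⇒qprops⊆ s
⊑⇒qprops⊆ (⊑-EUʳ {ψ} s)  = ∈-++⁺ʳ (qprops ψ) ∘ ⊑⇒qprops⊆ s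
⊑⇒qprops⊆ (⊑-AUˡ s)      = ∈-++⁺ˡ ∘ ⊑⇒qprops⊆ s
⊑⇒qprops⊆ (⊑-AUʳ {ψ} s)  = ∈-++⁺ʳ (qprops ψ) ∘ ⊑⇒qprops⊆ s
⊑⇒qprops⊆ (⊑-∃ s)        = there ∘ ⊑⇒qprops⊆ s

theorem1 : {N : ℕ} (K : Kripke N)
           (star? : (x y : Fin N) → Dec (Star (Kripke.E K) x y))
           (Φ φ : Form) (x : Fin N) (ε : Env N) →
           Unique (qprops Φ) →
           (∀ p → p ∈ qprops Φ → ∀ y → Kripke.ℓ K y p ≡ false) →
           (∀ p → T (is-just (ε p)) → p ∈ qprops Φ) →
           φ ⊑ Φ →
           (Sem.sat K (qprops Φ) ε x φ ⇔ (valEnv ε ⊨q Trans.tr K star? φ x (dom ε)))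
theorem1 K star? Φ φ x ε _ ℓ-free dom⊆qprops φ⊑Φ =
  tr-correct ℓ-free φ (⊑⇒qprops⊆ φ⊑Φ) encodes x
  where
  open Correctness K star? (qprops Φ)
  encodes : Encodes ε (dom ε) (valEnv ε)
  encodes = record { dom-≡ = λ _ → refl ; val-≡ = λ _ _ → refl ; dom⊆Q = dom⊆qprops }
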